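{- Let $\Gamma$ be a reduced graph. Then $2 \mid |\mathrm{Aut}(\Gamma)|$ if and only if $2 \mid |\mathrm{Aut}^{\pi}(\Gamma)|$.
   Context: Graphs are finite, simple, loopless; $N(v)$ is the neighbourhood of $v$; reduced means $N(v)=N(w)\Rightarrow v=w$. $\mathrm{Aut}^{\pi}(\Gamma)$ is the group of bijections $\pi$ of the vertex set such that for every vertex $v$ there exists a vertex $w$ with $\pi(N(v))=N(w)$. -}

module Defs where

open import Data.Nat using (ℕ; zero; suc)
open import Data.Bool using (Bool; false)
import Data.Bool.Properties as B
open import Data.Fin using (Fin)
open import Data.Fin.Properties using (_≟_; all?; any?)
open import Data.Vec using (Vec; []; _∷_; lookup)
open import Data.List using (List; [_]; concatMap; map; filter; length; allFin)
open import Data.Product using (Σ; ∃; _×_; _,_)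
open import Relation.Binary.PropositionalEquality using (_≡_)
open import Relation.Nullary using (Dec; _×-dec_; _→-dec_)

record Graph (n : ℕ) : Set where
  field
    E      : Fin n → Fin n → Bool
    sym    : ∀ u v → E u v ≡ E v u
    irrefl : ∀ v → E v v ≡ false
open Graph public

-- u ∈ N(v)  iff  E v u ≡ true.  N(v) = N(w) means the two neighbourhoods agree pointwise.
SameNbhd : ∀ {n} → Graph n → Fin n → Fin n → Set
SameNbhd Γ v w = ∀ u → E Γ v u ≡ E Γ w u

Reduced : ∀ {n} → Graph n → Set
Reduced {n} Γ = ∀ (v w : Fin n) → SameNbhd Γ v w → v ≡ w

IsBijection : ∀ {n} → (Fin n → Fin n) → Set
IsBijection {n} f = (∀ x y → f x ≡ f y → x ≡ y) × (∀ y → ∃ λ x → f x ≡ y)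

IsAut : ∀ {n} → Graph n → (Fin n → Fin n) → Set
IsAut Γ f = IsBijection f × (∀ u v → E Γ u v ≡ E Γ (f u) (f v))

-- π(N(v)) = N(w), written out: u ∈ N(v) ⇔ π u ∈ N(w) for all u
-- (this is exactly image-equality since π is a bijection).
MapsNbhdTo : ∀ {n} → Graph n → (Fin n → Fin n) → Fin n → Fin n → Set
MapsNbhdTo Γ π v w = ∀ u → E Γ v u ≡ E Γ w (π u)

IsAutπ : ∀ {n} → Graph n → (Fin n → Fin n) → Set
IsAutπ Γ π = IsBijection π × (∀ v → ∃ λ w → MapsNbhdTo Γ π v w)

isBijection? : ∀ {n} (f : Fin n → Fin n) → Dec (IsBijection f)
isBijection? f =
  all? (λ x → all? (λ y → (f x ≟ f y) →-dec (x ≟ y)))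
  ×-dec all? (λ y → any? (λ x → f x ≟ y))

isAut? : ∀ {n} (Γ : Graph n) (f : Fin n → Fin n) → Dec (IsAut Γ f)
isAut? Γ f = isBijection? f ×-dec
  all? (λ u → all? (λ v → E Γ u v B.≟ E Γ (f u) (f v)))

isAutπ? : ∀ {n} (Γ : Graph n) (f : Fin n → Fin n) → Dec (IsAutπ Γ f)
isAutπ? Γ f = isBijection? f ×-dec
  all? (λ v → any? (λ w → all? (λ u → E Γ v u B.≟ E Γ w (f u))))

allVecs : ∀ {A : Set} → List A → (k : ℕ) → List (Vec A k)
allVecs xs zero    = [ [] ]
allVecs xs (suc k) = concatMap (λ x → map (x ∷_) (allVecs xs k)) xs

-- all maps Fin n → Fin n, each represented exactly once as a vector of values
allMaps : (n : ℕ) → List (Vec (Fin n) n)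
allMaps n = allVecs (allFin n) n

∣Aut∣ : ∀ {n} → Graph n → ℕ
∣Aut∣ {n} Γ = length (filter (λ t → isAut? Γ (lookup t)) (allMaps n))

∣Autπ∣ : ∀ {n} → Graph n → ℕ
∣Autπ∣ {n} Γ = length (filter (λ t → isAutπ? Γ (lookup t)) (allMaps n))

-- For π ∈ Aut^π(Γ) let σ be the map with π(N(v)) = N(σ v); it is well defined
-- because Γ is reduced, and since adjacency is symmetric, σ(N(u)) = N(π u).  Hence
-- σ is injective (Γ reduced), so σ ∈ Aut^π(Γ), the map attached to σ is π again,
-- and π is attached to itself exactly when π ∈ Aut(Γ).  The involution π ↦ σ of
-- Aut^π(Γ) thus fixes Aut(Γ) and pairs up the rest, so |Aut^π(Γ)| ≡ |Aut(Γ)| mod 2.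
{-# OPTIONS --safe #-}
module Submission where

open import Defs renaming (sym to E-sym)
open import Data.Nat using (ℕ; zero; suc; _+_)
open import Data.Nat.Divisibility using (_∣_; _∣0; ∣-refl; ∣m∣n⇒∣m+n; ∣m+n∣m⇒∣n)
import Data.Nat.Properties as ℕ
open import Data.Empty using (⊥-elim)
open import Data.Fin using (Fin; punchOut)
import Data.Fin.Properties as Fin
open import Data.Vec using (Vec; []; _∷_; lookup; tabulate)
import Data.Vec.Properties as Vec
open import Data.List using (List; []; _∷_; filter; length; concatMap; map; _++_; cartesianProductWith)
import Data.List.Properties as List
open import Data.List.Membership.Propositional using (_∈_)
open import Data.List.Membership.Propositional.Properties
  using (∈-filter⁺; ∈-filter⁻; ∈-cartesianProductWith⁺; ∈-allFin)
open import Data.List.Relation.Unary.Any using (here; there)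
open import Data.List.Relation.Unary.All using ([])
import Data.List.Relation.Unary.All as All
open import Data.List.Relation.Unary.AllPairs using ([]; _∷_)
open import Data.List.Relation.Unary.Unique.Propositional using (Unique)
import Data.List.Relation.Unary.Unique.Propositional.Properties as Unique
open import Data.Product using (∃; _×_; _,_; proj₁; proj₂)
open import Function.Base using (_∘_)
open import Function.Bundles using (_⇔_; mk⇔; Equivalence)
open import Relation.Binary.Definitions using (DecidableEquality)
open import Relation.Binary.PropositionalEquality
  using (_≡_; _≢_; refl; sym; trans; cong; subst; _≗_; ≢-sym; module ≡-Reasoning)
open import Relation.Nullary using (yes; no)
open import Relation.Unary using (Decidable; _⊆_; _∩_; ∁)
open import Relation.Unary.Properties using (_∩?_; ∁?)

module InvolutionParity {A : Set} (_≟_ : DecidableEquality A) where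

  record IsFixedPointFreeInvolutionOn (τ : A → A) (xs : List A) : Set where
    field
      closed       : ∀ {x} → x ∈ xs → τ x ∈ xs
      involutive   : ∀ {x} → x ∈ xs → τ (τ x) ≡ x
      noFixedPoint : ∀ {x} → x ∈ xs → τ x ≢ x

  remove : A → List A → List A
  remove a = filter (∁? (_≟ a))

  length-remove : ∀ {a xs} → Unique xs → a ∈ xs → length xs ≡ suc (length (remove a xs))
  length-remove {a} {a ∷ ys} (a∉ys ∷ _) (here refl) = cong suc (begin
    length ys                  ≡⟨ cong length (List.filter-all (∁? (_≟ a)) (All.map ≢-sym a∉ys)) ⟨
    length (remove a ys)       ≡⟨ cong length (List.filter-reject (∁? (_≟ a)) (λ a≢a → a≢a refl)) ⟨
    length (remove a (a ∷ ys)) ∎)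
    where open ≡-Reasoning
  length-remove {a} {x ∷ ys} (x∉ys ∷ u) (there a∈ys) = begin
    suc (length ys)                 ≡⟨ cong suc (length-remove u a∈ys) ⟩
    suc (length (x ∷ remove a ys))  ≡⟨ cong (suc ∘ length) (List.filter-accept (∁? (_≟ a)) x≢a) ⟨
    suc (length (remove a (x ∷ ys))) ∎
    where
    open ≡-Reasoning
    x≢a : x ≢ a
    x≢a = All.lookup x∉ys a∈ys

  module _ {τ : A → A} where
    open IsFixedPointFreeInvolutionOn

    τ-head∈tail : ∀ {x ys} → IsFixedPointFreeInvolutionOn τ (x ∷ ys) → τ x ∈ ys
    τ-head∈tail inv with closed inv (here refl)
    ... | here τx≡x  = ⊥-elim (noFixedPoint inv (here refl) τx≡x)
    ... | there τx∈ys = τx∈ys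

    remove-partner : ∀ {x ys} → Unique (x ∷ ys) → IsFixedPointFreeInvolutionOn τ (x ∷ ys) →
                     IsFixedPointFreeInvolutionOn τ (remove (τ x) ys)
    remove-partner {x} {ys} (x∉ys ∷ _) inv = record
      { closed       = closed′
      ; involutive   = involutive inv ∘ there ∘ in-ys
      ; noFixedPoint = noFixedPoint inv ∘ there ∘ in-ys
      }
      where
      in-ys : ∀ {y} → y ∈ remove (τ x) ys → y ∈ ys
      in-ys = proj₁ ∘ ∈-filter⁻ (∁? (_≟ τ x))
      closed′ : ∀ {y} → y ∈ remove (τ x) ys → τ y ∈ remove (τ x) ys
      closed′ {y} y∈ with ∈-filter⁻ (∁? (_≟ τ x)) y∈
      ... | y∈ys , y≢τx with closed inv (there y∈ys)
      ... | here τy≡x    = ⊥-elim (y≢τx (trans (sym (involutive inv (there y∈ys))) (cong τ τy≡x)))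
      ... | there τy∈ys = ∈-filter⁺ (∁? (_≟ τ x)) τy∈ys λ τy≡τx →
            All.lookup x∉ys y∈ys (sym (begin
              y         ≡⟨ involutive inv (there y∈ys) ⟨
              τ (τ y)   ≡⟨ cong τ τy≡τx ⟩
              τ (τ x)   ≡⟨ involutive inv (here refl) ⟩
              x         ∎))
        where open ≡-Reasoning

    even-length : ∀ k xs → length xs ≡ k → Unique xs →
                  IsFixedPointFreeInvolutionOn τ xs → 2 ∣ k
    even-length zero          _        _  _ _ = 2 ∣0
    even-length (suc zero)    (x ∷ []) _  _ inv = ⊥-elim (noFixedPoint inv (here refl) τx≡x)
      where
      τx≡x : τ x ≡ x
      τx≡x with closed inv (here refl)
      ... | here τx≡x = τx≡x
    even-length (suc (suc k)) (x ∷ ys) eq u@(_ ∷ uys) inv =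
      ∣m∣n⇒∣m+n ∣-refl (even-length k (remove (τ x) ys) length-rest
                          (Unique.filter⁺ (∁? (_≟ τ x)) uys) (remove-partner u inv))
      where
      length-rest : length (remove (τ x) ys) ≡ k
      length-rest = ℕ.suc-injective
        (trans (sym (length-remove uys (τ-head∈tail inv))) (ℕ.suc-injective eq))

  length-filter-⊆ : ∀ {P Q : A → Set} (P? : Decidable P) (Q? : Decidable Q) → Q ⊆ P → ∀ xs →
    length (filter P? xs) ≡ length (filter (P? ∩? ∁? Q?) xs) + length (filter Q? xs)
  length-filter-⊆ P? Q? Q⊆P [] = refl
  length-filter-⊆ P? Q? Q⊆P (x ∷ xs) with P? x | Q? x
  ... | yes _ | yes _  = trans (cong suc (length-filter-⊆ P? Q? Q⊆P xs)) (sym (ℕ.+-suc _ _))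
  ... | yes _ | no _   = cong suc (length-filter-⊆ P? Q? Q⊆P xs)
  ... | no ¬p | yes q  = ⊥-elim (¬p (Q⊆P q))
  ... | no _  | no _   = length-filter-⊆ P? Q? Q⊆P xs

  even-fixedPoints⇔even : ∀ {P Q : A → Set} (P? : Decidable P) (Q? : Decidable Q) (τ : A → A)
    (L : List A) → Unique L → (∀ x → x ∈ L) →
    (∀ {x} → P x → P (τ x)) → (∀ {x} → P x → τ (τ x) ≡ x) → (∀ {x} → Q x ⇔ (P x × τ x ≡ x)) →
    2 ∣ length (filter Q? L) ⇔ 2 ∣ length (filter P? L)
  even-fixedPoints⇔even {P} {Q} P? Q? τ L uniqueL completeL P-closed involutive fixed⇔ =
    mk⇔ (λ even-Q → subst (2 ∣_) (sym count) (∣m∣n⇒∣m+n even-moved even-Q))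
        (λ even-P → ∣m+n∣m⇒∣n (subst (2 ∣_) count even-P) even-moved)
    where
    open Equivalence
    moved : List A
    moved = filter (P? ∩? ∁? Q?) L
    count : length (filter P? L) ≡ length moved + length (filter Q? L)
    count = length-filter-⊆ P? Q? (proj₁ ∘ to fixed⇔) L
    P∖Q : ∀ {x} → x ∈ moved → (P ∩ ∁ Q) x
    P∖Q = proj₂ ∘ ∈-filter⁻ (P? ∩? ∁? Q?) {xs = L}
    τ-moves : ∀ {x} → (P ∩ ∁ Q) x → τ x ≢ x
    τ-moves (p , ¬q) τx≡x = ¬q (from fixed⇔ (p , τx≡x))
    τ-moved : ∀ {x} → (P ∩ ∁ Q) x → (P ∩ ∁ Q) (τ x)
    τ-moved (p , ¬q) = P-closed p , λ q →
      τ-moves (p , ¬q) (trans (sym (proj₂ (to fixed⇔ q))) (involutive p))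
    even-moved : 2 ∣ length moved
    even-moved = even-length _ moved refl (Unique.filter⁺ (P? ∩? ∁? Q?) uniqueL) record
      { closed       = λ x∈ → ∈-filter⁺ (P? ∩? ∁? Q?) (completeL _) (τ-moved (P∖Q x∈))
      ; involutive   = involutive ∘ proj₁ ∘ P∖Q
      ; noFixedPoint = τ-moves ∘ P∖Q
      }

open InvolutionParity using (even-fixedPoints⇔even)

module _ {A : Set} where

  allVecs≡cartesianProduct : ∀ (xs : List A) k →
    allVecs xs (suc k) ≡ cartesianProductWith _∷_ xs (allVecs xs k)
  allVecs≡cartesianProduct xs k = go xs
    where
    go : ∀ ys → concatMap (λ y → map (y ∷_) (allVecs xs k)) ys
               ≡ cartesianProductWith _∷_ ys (allVecs xs k)
    go []       = refl
    go (y ∷ ys) = cong (map (y ∷_) (allVecs xs k) ++_) (go ys)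

  allVecs-unique : ∀ {xs} k → Unique xs → Unique (allVecs xs k)
  allVecs-unique zero    _  = [] ∷ []
  allVecs-unique {xs} (suc k) u rewrite allVecs≡cartesianProduct xs k =
    Unique.cartesianProductWith⁺ _∷_ Vec.∷-injective u (allVecs-unique k u)

  allVecs-complete : ∀ {xs} → (∀ x → x ∈ xs) → ∀ {k} (t : Vec A k) → t ∈ allVecs xs k
  allVecs-complete _ [] = here refl
  allVecs-complete {xs} complete {suc k} (x ∷ t) rewrite allVecs≡cartesianProduct xs k =
    ∈-cartesianProductWith⁺ _∷_ (complete x) (allVecs-complete complete t)

allMaps-unique : ∀ n → Unique (allMaps n)
allMaps-unique n = allVecs-unique n (Unique.allFin⁺ n)

allMaps-complete : ∀ {n} (t : Vec (Fin n) n) → t ∈ allMaps n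
allMaps-complete = allVecs-complete ∈-allFin

injective⇒surjective : ∀ {m} (f : Fin m → Fin m) → (∀ x y → f x ≡ f y → x ≡ y) →
                       ∀ y → ∃ λ x → f x ≡ y
injective⇒surjective {zero}  f f-inj ()
injective⇒surjective {suc m} f f-inj y with Fin.any? (λ x → f x Fin.≟ y)
... | yes hit = hit
... | no miss = ⊥-elim (ℕ.1+n≰n (Fin.injective⇒≤ punchOut-f-injective))
  where
  y≢f : ∀ x → y ≢ f x
  y≢f x y≡fx = miss (x , sym y≡fx)
  punchOut-f-injective : ∀ {x x′} → punchOut (y≢f x) ≡ punchOut (y≢f x′) → x ≡ x′
  punchOut-f-injective eq = f-inj _ _ (Fin.punchOut-injective (y≢f _) (y≢f _) eq)

lookup-injective : ∀ {A : Set} {k} {s t : Vec A k} → lookup s ≗ lookup t → s ≡ t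
lookup-injective {s = s} {t} s≗t = begin
  s                   ≡⟨ Vec.tabulate∘lookup s ⟨
  tabulate (lookup s) ≡⟨ Vec.tabulate-cong s≗t ⟩
  tabulate (lookup t) ≡⟨ Vec.tabulate∘lookup t ⟩
  t                   ∎
  where open ≡-Reasoning

module _ {n} (Γ : Graph n) where

  MapsNbhdsVia : (π σ : Fin n → Fin n) → Set
  MapsNbhdsVia π σ = ∀ v → MapsNbhdTo Γ π v (σ v)

  mapsNbhdsVia-flip : ∀ {π σ} → MapsNbhdsVia π σ → MapsNbhdsVia σ π
  mapsNbhdsVia-flip {π} {σ} π↝σ u v = begin
    E Γ u v         ≡⟨ E-sym Γ u v ⟩
    E Γ v u         ≡⟨ π↝σ v u ⟩
    E Γ (σ v) (π u) ≡⟨ E-sym Γ (σ v) (π u) ⟩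
    E Γ (π u) (σ v) ∎
    where open ≡-Reasoning

  partner : Vec (Fin n) n → Vec (Fin n) n
  partner t with isAutπ? Γ (lookup t)
  ... | yes (_ , nbhds) = tabulate (proj₁ ∘ nbhds)
  ... | no _            = t

  partner-mapsNbhds : ∀ {t} → IsAutπ Γ (lookup t) → MapsNbhdsVia (lookup t) (lookup (partner t))
  partner-mapsNbhds {t} p with isAutπ? Γ (lookup t)
  ... | yes (_ , nbhds) = λ v →
        subst (MapsNbhdTo Γ (lookup t) v) (sym (Vec.lookup∘tabulate _ v)) (proj₂ (nbhds v))
  ... | no ¬p           = ⊥-elim (¬p p)

  module _ (reduced : Reduced Γ) where

    mapsNbhdTo-unique : ∀ {π v w w′} → (∀ y → ∃ λ x → π x ≡ y) →
                        MapsNbhdTo Γ π v w → MapsNbhdTo Γ π v w′ → w ≡ w′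
    mapsNbhdTo-unique {π} {w = w} {w′} π-surj v↝w v↝w′ = reduced w w′ λ y →
      let (x , πx≡y) = π-surj y in
      subst (λ z → E Γ w z ≡ E Γ w′ z) πx≡y (trans (sym (v↝w x)) (v↝w′ x))

    mapsNbhdsVia-unique : ∀ {π σ σ′} → (∀ y → ∃ λ x → π x ≡ y) →
                          MapsNbhdsVia π σ → MapsNbhdsVia π σ′ → σ ≗ σ′
    mapsNbhdsVia-unique π-surj π↝σ π↝σ′ v = mapsNbhdTo-unique π-surj (π↝σ v) (π↝σ′ v)

    mapsNbhdsVia-injective : ∀ {π σ} → MapsNbhdsVia π σ → ∀ x y → σ x ≡ σ y → x ≡ y
    mapsNbhdsVia-injective {π} π↝σ x y σx≡σy = reduced x y λ u →
      trans (π↝σ x u) (trans (cong (λ z → E Γ z (π u)) σx≡σy) (sym (π↝σ y u)))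

    mapsNbhdsVia⇒isAutπ : ∀ {π σ} → MapsNbhdsVia π σ → IsAutπ Γ σ
    mapsNbhdsVia⇒isAutπ {π} {σ} π↝σ =
      (σ-injective , injective⇒surjective σ σ-injective) , λ u → π u , mapsNbhdsVia-flip π↝σ u
      where
      σ-injective : ∀ x y → σ x ≡ σ y → x ≡ y
      σ-injective = mapsNbhdsVia-injective π↝σ

    partner-isAutπ : ∀ {t} → IsAutπ Γ (lookup t) → IsAutπ Γ (lookup (partner t))
    partner-isAutπ p = mapsNbhdsVia⇒isAutπ (partner-mapsNbhds p)

    partner-involutive : ∀ {t} → IsAutπ Γ (lookup t) → partner (partner t) ≡ t
    partner-involutive p = lookup-injective (mapsNbhdsVia-unique (proj₂ (proj₁ p′))
      (partner-mapsNbhds p′) (mapsNbhdsVia-flip (partner-mapsNbhds p)))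
      where p′ = partner-isAutπ p

    isAut⇔partner-fixed : ∀ {t} → IsAut Γ (lookup t) ⇔ (IsAutπ Γ (lookup t) × partner t ≡ t)
    isAut⇔partner-fixed {t} = mk⇔ to from
      where
      -- IsAut Γ π unfolds to IsBijection π × MapsNbhdsVia π π.
      to : IsAut Γ (lookup t) → IsAutπ Γ (lookup t) × partner t ≡ t
      to (bij , π↝π) = p , lookup-injective
        (mapsNbhdsVia-unique (proj₂ bij) (partner-mapsNbhds p) π↝π)
        where p = bij , λ v → lookup t v , π↝π v
      from : IsAutπ Γ (lookup t) × partner t ≡ t → IsAut Γ (lookup t)
      from (p , fixed) =
        proj₁ p , subst (MapsNbhdsVia (lookup t) ∘ lookup) fixed (partner-mapsNbhds p)

corollary2p9 : (n : ℕ) (Γ : Graph n) → Reduced Γ →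
    (2 ∣ ∣Aut∣ Γ) ⇔ (2 ∣ ∣Autπ∣ Γ)
corollary2p9 n Γ reduced =
  even-fixedPoints⇔even (Vec.≡-dec Fin._≟_) (isAutπ? Γ ∘ lookup) (isAut? Γ ∘ lookup) (partner Γ)
    (allMaps n) (allMaps-unique n) allMaps-complete
    (partner-isAutπ Γ reduced) (partner-involutive Γ reduced) (isAut⇔partner-fixed Γ reduced)
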